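{- Let $T$ be a symmetric functor from $\mathsf{Rel}^I$ to $\mathsf{Rel}$, let $(\mathrm{own}_i)_{i\in I}$ be an ownership relation on $T$, and assume this transport situation admits a shape relation. Then for all families of finiteness spaces $(\mathcal A_i)_{i\in I}$, $(\mathcal B_i)_{i\in I}$ and every family of relations $(f_i)_{i\in I}$ such that each $f_i$ is finitary from $\mathcal A_i$ to $\mathcal B_i$, the relation $T\vec f$ is finitary from $T_{\mathrm{own}}\vec{\mathcal A}$ to $T_{\mathrm{own}}\vec{\mathcal B}$. Consequently $T_{\mathrm{own}}$ (acting as $T$ on relations) is a functor from $\mathsf{Fin}^I$ to $\mathsf{Fin}$.
   Context: Finiteness: for $\mathfrak A\subseteq\mathcal P(A)$, $\mathfrak A^{\perp}=\{a'\subseteq A: a\cap a'\text{ finite }\forall a\in\mathfrak A\}$; a finiteness structure is $\mathfrak A$ with $\mathfrak A^{\perp\perp}=\mathfrak A$; a finiteness space $\mathcal A=(|\mathcal A|,\mathfrak F(\mathcal A))$ is a set with a finiteness structure; its dual is $\mathcal A^\perp=(|\mathcal A|,\mathfrak F(\mathcal A)^\perp)$. For a relation $f\subseteq A\times B$: $f[a]$ is the direct image of $a\subseteq A$, $f^\dagger=\{(\beta,\alpha):(\alpha,\beta)\in f\}$ is the reverse relation, and $f$ is quasi-functional if $f[\{\alpha\}]$ is finite for all $\alpha$. A relation $f\subseteq|\mathcal A|\times|\mathcal B|$ is finitary from $\mathcal A$ to $\mathcal B$ if $f[a]\in\mathfrak F(\mathcal B)$ for all $a\in\mathfrak F(\mathcal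 A)$ and $f^\dagger[b']\in\mathfrak F(\mathcal A^\perp)$ for all $b'\in\mathfrak F(\mathcal B^\perp)$; $\mathsf{Fin}$ is the category of finiteness spaces and finitary relations, $\mathsf{Fin}^I$ its $I$-fold product (families, componentwise). A functor $T$ from $\mathsf{Rel}^I$ to $\mathsf{Rel}$ assigns a set $T\vec A$ to every family of sets $\vec A=(A_i)_{i\in I}$ and a relation $T\vec f$ to every family of relations $\vec f=(f_i)_{i\in I}$, such that $T\vec f\subseteq T\vec A\times T\vec B$ whenever $f_i\subseteq A_i\times B_i$ for all $i$ (the image does not depend on the chosen sources/targets), preserving componentwise identities and composition. $T$ is symmetric if $T(\vec f^{\,\dagger})=(T\vec f)^\dagger$ (componentwise reverse). A lax natural transformation $\phi$ from $T$ to $U$ is a family of relations $\phi_{\vec A}\subseteq T\vec A\times U\vec A$ such that $\phi_{\vec B}\circ T\vec g\subseteq U\vec g\circ\phi_{\vec A}$ for every family of relations $g_i\subseteq A_i\times B_i$. $\Pi_i$ is the $i$-th projection functor ($\Pi_i\vec A=A_i$, $\Pi_i\vec f=f_i$); for a set $S$, $E_S$ is the constant functor ($E_S\vec A=S$, $E_S\vec f=\mathrm{id}_S$). An ownership relation on $T$ is a family $(\mathrm{own}_i)_{i\in I}$ where each $\mathrm{own}_i$ is a quasi-functional lax natural transformation from $T$ to $\Pi_i$; for a family of finiteness spaces $\vec{\mathcal A}$ one sets $T_{\mathrm{own}}\vec{\mathcal A}=\big(T(|\mathcal A_i|)_i,\ \{\hat a\subseteq T(|\mathcal A_i|)_i:\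 \forall i,\ \mathrm{own}_i[\hat a]\in\mathfrak F(\mathcal A_i)\}\big)$, which is a finiteness space. A shape relation for $(T,\mathrm{own})$ is a set $S$ together with a quasi-functional lax natural transformation $\mathrm{shp}$ from $T$ to $E_S$ such that for every family of sets $\vec A$ and every $\hat a\subseteq T\vec A$, if $\mathrm{shp}[\hat a]$ is finite and $\mathrm{own}_i[\hat a]$ is finite for every $i\in I$, then $\hat a$ is finite. -}

module Defs where

open import Level using (Level; 0ℓ) renaming (suc to lsuc)
open import Data.Product using (Σ; ∃; _×_; _,_; proj₁; proj₂)
open import Data.List using (List)
open import Data.List.Membership.Propositional using (_∈_)
open import Relation.Binary.PropositionalEquality using (_≡_; refl; sym; trans)
open import Function.Bundles using (_⇔_; mk⇔)

Subset : Set → Set₁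
Subset A = A → Set

Rel : Set → Set → Set₁
Rel A B = A → B → Set

_∩_ : {A : Set} → Subset A → Subset A → Subset A
(a ∩ b) x = a x × b x

_⊆_ : {A : Set} → Subset A → Subset A → Set
a ⊆ b = ∀ x → a x → b x

｛_｝ : {A : Set} → A → Subset A
｛ α ｝ = λ x → x ≡ α

Finite : {A : Set} → Subset A → Set
Finite {A} a = Σ (List A) λ xs → ∀ x → a x → x ∈ xs

_[_] : {A B : Set} → Rel A B → Subset A → Subset B
(f [ a ]) y = ∃ λ x → a x × f x y

_† : {A B : Set} → Rel A B → Rel B A
(f †) y x = f x y

idᵣ : {A : Set} → Rel A A
idᵣ x y = x ≡ y

_∘ᵣ_ : {A B C : Set} → Rel B C → Rel A B → Rel A C
(g ∘ᵣ f) x z = ∃ λ y → f x y × g y z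

_≐_ : {A B : Set} → Rel A B → Rel A B → Set
f ≐ g = ∀ x y → f x y ⇔ g x y

_⊑_ : {A B : Set} → Rel A B → Rel A B → Set
f ⊑ g = ∀ x y → f x y → g x y

QuasiFunctional : {A B : Set} → Rel A B → Set
QuasiFunctional f = ∀ α → Finite (f [ ｛ α ｝ ])

_⊥ : {A : Set} → (Subset A → Set₁) → (Subset A → Set₁)
(𝔄 ⊥) a′ = ∀ a → 𝔄 a → Finite (a ∩ a′)

IsFinitenessStructure : {A : Set} → (Subset A → Set₁) → Set₁
IsFinitenessStructure 𝔄 = ∀ a → ((𝔄 ⊥) ⊥) a ⇔ 𝔄 a

record FinSpace : Set₂ where
  field
    ∣_∣    : Set
    𝔉      : Subset ∣_∣ → Set₁
    isFinStr : IsFinitenessStructure 𝔉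
open FinSpace public

FinitaryStr : {A B : Set} → (Subset A → Set₁) → (Subset B → Set₁) → Rel A B → Set₁
FinitaryStr 𝔄 𝔅 f =
  (∀ a → 𝔄 a → 𝔅 (f [ a ])) × (∀ b′ → (𝔅 ⊥) b′ → (𝔄 ⊥) ((f †) [ b′ ]))

Finitary : (𝒜 ℬ : FinSpace) → Rel ∣ 𝒜 ∣ ∣ ℬ ∣ → Set₁
Finitary 𝒜 ℬ f = FinitaryStr (𝔉 𝒜) (𝔉 ℬ) f

record RelFunctor (I : Set) : Set₂ where
  field
    obj    : (I → Set) → Set
    hom    : {A B : I → Set} → (∀ i → Rel (A i) (B i)) → Rel (obj A) (obj B)
    -- relations are sets: pointwise-equivalent relations have the same image
    hom-cong : {A B : I → Set} (f g : ∀ i → Rel (A i) (B i)) →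
               (∀ i → f i ≐ g i) → hom f ≐ hom g
    hom-id : {A : I → Set} → hom {A} {A} (λ i → idᵣ) ≐ idᵣ
    hom-∘  : {A B C : I → Set} (f : ∀ i → Rel (A i) (B i)) (g : ∀ i → Rel (B i) (C i)) →
             hom (λ i → g i ∘ᵣ f i) ≐ (hom g ∘ᵣ hom f)
open RelFunctor public

Symmetric : {I : Set} → RelFunctor I → Set₁
Symmetric T = ∀ {A B : _ → Set} (f : ∀ i → Rel (A i) (B i)) →
              hom T (λ i → f i †) ≐ (hom T f †)

record LaxNat {I : Set} (T U : RelFunctor I) : Set₂ where
  field
    φ   : (A : I → Set) → Rel (obj T A) (obj U A)
    lax : {A B : I → Set} (g : ∀ i → Rel (A i) (B i)) →
          (φ B ∘ᵣ hom T g) ⊑ (hom U g ∘ᵣ φ A)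
open LaxNat public

Πᶠ : {I : Set} → I → RelFunctor I
obj (Πᶠ i) A = A i
hom (Πᶠ i) f = f i
hom-cong (Πᶠ i) f g e = e i
hom-id (Πᶠ i) x y = mk⇔ (λ p → p) (λ p → p)
hom-∘ (Πᶠ i) f g x z = mk⇔ (λ p → p) (λ p → p)

Eᶠ : {I : Set} → Set → RelFunctor I
obj (Eᶠ S) A = S
hom (Eᶠ S) f = idᵣ
hom-cong (Eᶠ S) f g e x y = mk⇔ (λ p → p) (λ p → p)
hom-id (Eᶠ S) x y = mk⇔ (λ p → p) (λ p → p)
hom-∘ (Eᶠ S) f g x z = mk⇔ (λ p → x , refl , p) (λ { (y , p , q) → trans p q })

record Ownership {I : Set} (T : RelFunctor I) : Set₂ where
  field
    own    : (i : I) → LaxNat T (Πᶠ i)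
    own-qf : (i : I) (A : I → Set) → QuasiFunctional (φ (own i) A)
open Ownership public

T∣_∣ : {I : Set} (T : RelFunctor I) → (I → FinSpace) → Set
T∣ T ∣ 𝒜 = obj T (λ i → ∣ 𝒜 i ∣)

T-own-𝔉 : {I : Set} (T : RelFunctor I) (o : Ownership T) (𝒜 : I → FinSpace) →
          Subset (T∣ T ∣ 𝒜) → Set₁
T-own-𝔉 T o 𝒜 â = ∀ i → 𝔉 (𝒜 i) (φ (own o i) (λ j → ∣ 𝒜 j ∣) [ â ])

record ShapeRelation {I : Set} (T : RelFunctor I) (o : Ownership T) : Set₂ where
  field
    S      : Set
    shp    : LaxNat T (Eᶠ S)
    shp-qf : (A : I → Set) → QuasiFunctional (φ shp A)
    shape  : (A : I → Set) (â : Subset (obj T A)) →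
             Finite (φ shp A [ â ]) →
             (∀ i → Finite (φ (own o i) A [ â ])) →
             Finite â

module Submission where

-- Write F = T f. Finitarity has a forward and a backward half.
--   * Forward: by lax naturality of own_i, own_i[F[â]] ⊆ f_i[own_i[â]], and
--     the latter lies in 𝔉(ℬ_i) because f_i is finitary; finiteness
--     structures are downward closed.
--   * Backward: for â ∈ T_own 𝒜 and b̂′ ∈ (T_own ℬ)^⊥ we must bound â ∩ F†[b̂′].
--     It is contained in the union, over the finite set F[â] ∩ b̂′, of the
--     fibres â ∩ F†[{y}]. Each fibre is finite by the shape property:
--     by symmetry F† = T(f†), so lax naturality puts its shape inside the
--     finite set shp[{y}], and its i-th ownership inside the union, over the
--     finite set own_i[{y}], of the sets own_i[â] ∩ f_i†[{z}], each finite
--     because f_i†[{z}] belongs to 𝔉(𝒜_i)^⊥ (singletons are in every dual).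

open import Defs
open import Data.Product using (_,_; proj₁; proj₂)
open import Data.List using (_∷_; []; concatMap)
open import Data.List.Membership.Propositional using (lose)
open import Data.List.Membership.Propositional.Properties using (∈-concatMap⁺)
open import Data.List.Relation.Unary.Any using (here)
open import Relation.Binary.PropositionalEquality using (refl)
open import Function.Bundles using (Equivalence)

Finite-⊆ : {A : Set} {a b : Subset A} → a ⊆ b → Finite b → Finite a
Finite-⊆ a⊆b (xs , b⊆xs) = xs , λ x ax → b⊆xs x (a⊆b x ax)

Finite-｛｝ : {A : Set} (α : A) → Finite ｛ α ｝
Finite-｛｝ α = α ∷ [] , λ x x≡α → here x≡α

image-mono : {A B : Set} (g : Rel A B) {a b : Subset A} → a ⊆ b → (g [ a ]) ⊆ (g [ b ])
image-mono g a⊆b y (x , ax , gxy) = x , a⊆b x ax , gxy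

idᵣ-image : {A : Set} (a : Subset A) → (idᵣ [ a ]) ⊆ a
idᵣ-image a y (.y , ay , refl) = ay

-- The image of a finite set meets c finitely as soon as the image of each of
-- its points does: c ∩ g[X] is the union of the c ∩ g[{z}], z ∈ X.
Finite-∩-image : {A B : Set} (g : Rel B A) (c : Subset A) {X : Subset B} →
                 Finite X → (∀ z → Finite (c ∩ (g [ ｛ z ｝ ]))) →
                 Finite (c ∩ (g [ X ]))
Finite-∩-image g c (zs , X⊆zs) fibre =
  concatMap (λ z → proj₁ (fibre z)) zs ,
  λ { x (cx , z , Xz , gzx) →
        ∈-concatMap⁺ (λ z → proj₁ (fibre z))
          (lose (X⊆zs z Xz) (proj₂ (fibre z) x (cx , z , refl , gzx))) }

-- Finiteness structures are downward closed (a ⊆ b ∈ 𝔉 gives a ∈ 𝔉), since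
-- membership is tested by the biorthogonal.
𝔉-⊆ : (𝒞 : FinSpace) {a b : Subset ∣ 𝒞 ∣} → a ⊆ b → 𝔉 𝒞 b → 𝔉 𝒞 a
𝔉-⊆ 𝒞 {a} {b} a⊆b b∈𝔉 = Equivalence.to (isFinStr 𝒞 a) λ c c∈𝔉⊥ →
  Finite-⊆ (λ x (cx , ax) → cx , a⊆b x ax)
           (Equivalence.from (isFinStr 𝒞 b) b∈𝔉 c c∈𝔉⊥)

｛｝∈⊥ : {A : Set} (𝔄 : Subset A → Set₁) (α : A) → (𝔄 ⊥) ｛ α ｝
｛｝∈⊥ 𝔄 α a _ = Finite-⊆ (λ x → proj₂) (Finite-｛｝ α)

lax-image : {I : Set} {T U : RelFunctor I} (η : LaxNat T U)
            {A B : I → Set} (g : ∀ i → Rel (A i) (B i)) (â : Subset (obj T A)) →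
            (φ η B [ hom T g [ â ] ]) ⊆ (hom U g [ φ η A [ â ] ])
lax-image η g â v (t , (x , âx , gxt) , ηtv) with lax η g x v (t , gxt , ηtv)
... | u , ηxu , guv = u , (x , âx , ηxu) , guv

T-own-image : {I : Set} (T : RelFunctor I) (o : Ownership T) (𝒜 ℬ : I → FinSpace)
              (f : ∀ i → Rel ∣ 𝒜 i ∣ ∣ ℬ i ∣) →
              (∀ i a → 𝔉 (𝒜 i) a → 𝔉 (ℬ i) (f i [ a ])) →
              ∀ â → T-own-𝔉 T o 𝒜 â → T-own-𝔉 T o ℬ (hom T f [ â ])
T-own-image T o 𝒜 ℬ f f-fwd â â∈𝔉 i =
  𝔉-⊆ (ℬ i) (lax-image (own o i) f â) (f-fwd i _ (â∈𝔉 i))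

-- The fibres of T f over single points, restricted to a set of T_own 𝒜, are
-- finite: their shape and all their ownerships are finite.
T-own-fibre-finite :
  {I : Set} (T : RelFunctor I) → Symmetric T →
  (o : Ownership T) → ShapeRelation T o →
  (𝒜 ℬ : I → FinSpace) (f : ∀ i → Rel ∣ 𝒜 i ∣ ∣ ℬ i ∣) →
  (∀ i b′ → (𝔉 (ℬ i) ⊥) b′ → (𝔉 (𝒜 i) ⊥) ((f i †) [ b′ ])) →
  ∀ â → T-own-𝔉 T o 𝒜 â → ∀ y → Finite (â ∩ ((hom T f †) [ ｛ y ｝ ]))
T-own-fibre-finite {I} T symm o sh 𝒜 ℬ f f-bwd â â∈𝔉 y =
  shape A fibre shape-finite owner-finite
  where
  open ShapeRelation sh
  A B : I → Set
  A i = ∣ 𝒜 i ∣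
  B i = ∣ ℬ i ∣
  f† : ∀ i → Rel (B i) (A i)
  f† i = f i †
  fibre : Subset (obj T A)
  fibre = â ∩ ((hom T f †) [ ｛ y ｝ ])

  -- by symmetry, the fibre lies in the T(f†)-image of {y}
  fibre⊆ : fibre ⊆ (hom T f† [ ｛ y ｝ ])
  fibre⊆ x (_ , y′ , y′≡y , Fxy′) = y′ , y′≡y , Equivalence.from (symm f y′ x) Fxy′

  -- its shape lies in shp[{y}], which is finite
  shape-finite : Finite (φ shp A [ fibre ])
  shape-finite = Finite-⊆
    (λ s s∈ → idᵣ-image _ s (lax-image shp f† ｛ y ｝ s (image-mono (φ shp A) fibre⊆ s s∈)))
    (shp-qf B y)

  -- its i-th ownership lies in own_i[â] ∩ f_i†[own_i[{y}]], which is finite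
  -- because own_i[{y}] is finite and each f_i†[{z}] is in 𝔉(𝒜_i)^⊥
  owner-finite : ∀ i → Finite (φ (own o i) A [ fibre ])
  owner-finite i = Finite-⊆
    (λ u u∈ → image-mono (φ (own o i) A) (λ x → proj₁) u u∈ ,
              lax-image (own o i) f† ｛ y ｝ u (image-mono (φ (own o i) A) fibre⊆ u u∈))
    (Finite-∩-image (f† i) _ (own-qf o i B y)
      λ z → f-bwd i ｛ z ｝ (｛｝∈⊥ (𝔉 (ℬ i)) z) _ (â∈𝔉 i))

lemma5 : {I : Set} (T : RelFunctor I) → Symmetric T →
         (o : Ownership T) → ShapeRelation T o →
         (𝒜 ℬ : I → FinSpace) (f : ∀ i → Rel ∣ 𝒜 i ∣ ∣ ℬ i ∣) →
         (∀ i → Finitary (𝒜 i) (ℬ i) (f i)) →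
         FinitaryStr (T-own-𝔉 T o 𝒜) (T-own-𝔉 T o ℬ) (hom T f)
lemma5 T symm o sh 𝒜 ℬ f fin = forward , backward
  where
  forward : ∀ â → T-own-𝔉 T o 𝒜 â → T-own-𝔉 T o ℬ (hom T f [ â ])
  forward = T-own-image T o 𝒜 ℬ f (λ i → proj₁ (fin i))

  -- â ∩ F†[b̂′] ⊆ â ∩ F†[F[â] ∩ b̂′], a union of finite fibres over a finite set
  backward : ∀ b̂′ → (T-own-𝔉 T o ℬ ⊥) b̂′ → (T-own-𝔉 T o 𝒜 ⊥) ((hom T f †) [ b̂′ ])
  backward b̂′ b̂′∈⊥ â â∈𝔉 = Finite-⊆
    (λ x (âx , y , b̂′y , Fxy) → âx , y , ((x , âx , Fxy) , b̂′y) , Fxy)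
    (Finite-∩-image (hom T f †) â (b̂′∈⊥ _ (forward â â∈𝔉))
      (T-own-fibre-finite T symm o sh 𝒜 ℬ f (λ i → proj₂ (fin i)) â â∈𝔉))
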